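{- Let $(G,c,k)$ be an instance of \textsc{ECS} with $G=(V,E)$, let $D\subseteq E$ be such that $(V,E\setminus D)$ has maximum degree at most $c-1$, and let $\mathscr{C}$ be the set of vertices incident with at least one edge of $D$. Let $G'$ be obtained from $G$ by deleting all vertices of $V\setminus(\mathscr{C}\cup N(\mathscr{C}))$. Then $(G,c,k)$ is a yes-instance if and only if $(G',c,k)$ is a yes-instance.
   Context: A $c$-colored labeling of $G=(V,E)$ is a partition $L=(S^1_L,\dots,S^c_L,W_L)$ of $E$ into strong color classes $S^i_L$ and weak edges $W_L$; it is proper if no two distinct edges sharing an endpoint lie in the same $S^i_L$. \textsc{ECS}: given a graph $G$ and integers $c,k$, decide whether $G$ has a proper $c$-colored labeling with $|W_L|\le k$. $N(\mathscr{C})=\bigcup_{v\in\mathscr{C}}N(v)$. -}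

module Defs where

open import Data.Nat using (ℕ; zero; suc; _+_; _≤_; _<_; _<ᵇ_)
open import Data.Fin using (Fin; zero; suc; toℕ)
open import Data.Bool using (Bool; true; false; _∧_; _∨_; not; if_then_else_)
open import Data.Bool.Properties using (∧-comm)
open import Data.Maybe using (Maybe; just; nothing; is-nothing)
open import Data.Product using (Σ; _×_; _,_)
open import Data.Empty using (⊥)
open import Relation.Binary.PropositionalEquality using (_≡_; _≢_; refl; cong; cong₂; trans)
open import Function using (_∘_)

countFin : (n : ℕ) → (Fin n → Bool) → ℕ
countFin zero    p = 0
countFin (suc n) p = (if p zero then 1 else 0) + countFin n (p ∘ suc)

sumFin : (n : ℕ) → (Fin n → ℕ) → ℕ
sumFin zero    f = 0
sumFin (suc n) f = f zero + sumFin n (f ∘ suc)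

anyFin : (n : ℕ) → (Fin n → Bool) → Bool
anyFin zero    p = false
anyFin (suc n) p = p zero ∨ anyFin n (p ∘ suc)

-- A finite simple graph: vertex set V ⊆ Fin n, edge set given by a
-- symmetric irreflexive adjacency relation on V.  The edge {u,v} is
-- present iff adj u v ≡ true.
record Graph (n : ℕ) : Set where
  field
    vert    : Fin n → Bool
    adj     : Fin n → Fin n → Bool
    adj-sym : ∀ u v → adj u v ≡ adj v u
    adj-irr : ∀ v → adj v v ≡ false
    adj-V   : ∀ u v → adj u v ≡ true → vert u ≡ true
open Graph public

-- c-colored labeling: each edge {u,v} gets a label lab u v : Maybe (Fin c);
-- just i  = strong colour class S^i,  nothing = weak edge.
-- (Values on non-edges are irrelevant.)  Well-defined on unordered edges:
IsLabeling : ∀ {n} (G : Graph n) (c : ℕ) → (Fin n → Fin n → Maybe (Fin c)) → Set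
IsLabeling {n} G c lab = ∀ u v → adj G u v ≡ true → lab u v ≡ lab v u

IsProper : ∀ {n} (G : Graph n) (c : ℕ) → (Fin n → Fin n → Maybe (Fin c)) → Set
IsProper {n} G c lab =
  ∀ (u v w : Fin n) (i : Fin c) → adj G u v ≡ true → adj G u w ≡ true → v ≢ w →
  lab u v ≡ just i → lab u w ≡ just i → ⊥

weakCount : ∀ {n} (G : Graph n) (c : ℕ) → (Fin n → Fin n → Maybe (Fin c)) → ℕ
weakCount {n} G c lab =
  sumFin n (λ u → countFin n (λ v → (toℕ u <ᵇ toℕ v) ∧ (adj G u v ∧ is-nothing (lab u v))))

ECS : ∀ {n} → Graph n → ℕ → ℕ → Set
ECS {n} G c k = Σ (Fin n → Fin n → Maybe (Fin c)) λ lab →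
  IsLabeling G c lab × IsProper G c lab × weakCount G c lab ≤ k

IsEdgeSubset : ∀ {n} → Graph n → (Fin n → Fin n → Bool) → Set
IsEdgeSubset {n} G D = (∀ u v → D u v ≡ D v u) × (∀ u v → D u v ≡ true → adj G u v ≡ true)

degMinus : ∀ {n} → Graph n → (Fin n → Fin n → Bool) → Fin n → ℕ
degMinus {n} G D v = countFin n (λ w → adj G v w ∧ not (D v w))

inC : ∀ {n} → (Fin n → Fin n → Bool) → Fin n → Bool
inC {n} D v = anyFin n (λ w → D v w)

inNC : ∀ {n} → Graph n → (Fin n → Fin n → Bool) → Fin n → Bool
inNC {n} G D v = anyFin n (λ u → inC D u ∧ adj G u v)

keep : ∀ {n} → Graph n → (Fin n → Fin n → Bool) → Fin n → Bool
keep G D v = inC D v ∨ inNC G D v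

private
  ∧-true-l : ∀ {a b} → a ∧ b ≡ true → a ≡ true
  ∧-true-l {true} _ = refl

reduce : ∀ {n} → (G : Graph n) → (Fin n → Fin n → Bool) → Graph n
reduce G D = record
  { vert    = λ v → vert G v ∧ keep G D v
  ; adj     = λ u v → adj G u v ∧ (keep G D u ∧ keep G D v)
  ; adj-sym = λ u v → cong₂ _∧_ (adj-sym G u v) (∧-comm (keep G D u) (keep G D v))
  ; adj-irr = λ v → cong (_∧ (keep G D v ∧ keep G D v)) (adj-irr G v)
  ; adj-V   = λ u v e → lemma u v e
  }
  where
  lemma : ∀ u v → adj G u v ∧ (keep G D u ∧ keep G D v) ≡ true → vert G u ∧ keep G D u ≡ true
  lemma u v e with adj G u v in eq | keep G D u
  ... | true | true rewrite adj-V G u v eq = refl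
  ... | true | false with () ← e
  ... | false | _ with () ← e

-- A labeling of G restricts to the induced subgraph G′ without gaining weak
-- edges.  Conversely, read a labeling L′ of G′ as a partial proper edge
-- colouring (weak = uncoloured) of the graph H formed by all edges of G
-- except the weak edges of L′.  Every edge of H that L′ leaves uncoloured has
-- a deleted endpoint x; x and its neighbours lie outside 𝒞, hence have degree
-- below c.  Under exactly this hypothesis Vizing's fan-and-Kempe-chain
-- argument colours the edge x y without uncolouring any other edge, so all of
-- H gets coloured and the weak edges of the result are weak edges of L′.
module Submission where

open import Defs
open import Data.Nat using (ℕ; zero; suc; _≤_; _<_; z≤n; s≤s; _<ᵇ_)
open import Data.Nat.Properties using (≤-refl; ≤-trans; ≤-<-trans; <-≤-trans; ≤-pred; n≤1+n; m≤n+m; +-mono-≤; <-irrefl)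
open import Data.Fin using (Fin; zero; suc; toℕ; punchIn)
open import Data.Fin.Properties using (_≟_; any?; all?; punchIn-injective; punchInᵢ≢i)
open import Data.Fin.Permutation.Components using (transpose)
open import Data.Bool using (Bool; true; false; not; _∧_; _∨_)
open import Data.Bool.Properties using (¬-not) renaming (_≟_ to _≟B_)
open import Data.Maybe using (Maybe; just; nothing; is-nothing) renaming (map to mapMaybe)
open import Data.Maybe.Properties using (just-injective) renaming (≡-dec to ≡-dec-Maybe)
open import Data.Product using (Σ; _×_; _,_; proj₁; proj₂)
open import Data.Sum using (_⊎_; inj₁; inj₂)
open import Data.List using (List; []; _∷_; allFin; cartesianProduct)
open import Data.List.Relation.Unary.Any using (here; there)
open import Data.List.Membership.Propositional using (_∈_; _∉_)
open import Data.List.Membership.Propositional.Properties using (∈-allFin; ∈-cartesianProduct⁺)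
open import Data.Empty using (⊥; ⊥-elim)
open import Relation.Nullary using (¬_; Dec; yes; no; does; ¬?; _×-dec_; _⊎-dec_)
open import Relation.Nullary.Decidable using (dec-true; dec-false)
open import Relation.Binary.PropositionalEquality using (_≡_; _≢_; refl; sym; trans; cong; cong₂; subst)
open import Function using (_∘_)
open import Function.Bundles using (_⇔_; mk⇔)

∧-true-l : ∀ {a b} → a ∧ b ≡ true → a ≡ true
∧-true-l {true} _ = refl

∧-true-r : ∀ {a b} → a ∧ b ≡ true → b ≡ true
∧-true-r {true} b≡true = b≡true

∧-true : ∀ {a b} → a ≡ true → b ≡ true → a ∧ b ≡ true
∧-true refl refl = refl

∨-false-l : ∀ {a b} → a ∨ b ≡ false → a ≡ false
∨-false-l {false} _ = refl

∨-false-r : ∀ {a b} → a ∨ b ≡ false → b ≡ false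
∨-false-r {false} b≡false = b≡false

∧-false-r : ∀ {a b} → a ≡ true → a ∧ b ≡ false → b ≡ false
∧-false-r refl b≡false = b≡false

∧-false : ∀ {a b} → a ∧ b ≡ false → (a ≡ false) ⊎ (b ≡ false)
∧-false {false} _        = inj₁ refl
∧-false {true}  b≡false = inj₂ b≡false

not-true⇒false : ∀ {b} → not b ≡ true → b ≡ false
not-true⇒false {false} _ = refl

true≢false : ∀ {b} → b ≡ true → b ≡ false → ⊥
true≢false refl ()

is-nothing⇒≡nothing : ∀ {A : Set} {m : Maybe A} → is-nothing m ≡ true → m ≡ nothing
is-nothing⇒≡nothing {m = nothing} _ = refl

≡nothing⇒is-nothing : ∀ {A : Set} {m : Maybe A} → m ≡ nothing → is-nothing m ≡ true
≡nothing⇒is-nothing refl = refl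

-- The main fact is 'injection⇒≤countFin': m distinct
-- elements satisfying p force countFin n p ≥ m; it turns "every colour is
-- used at v" into "v has at least c neighbours".

countFin-mono : ∀ n (p q : Fin n → Bool) → (∀ i → p i ≡ true → q i ≡ true) →
  countFin n p ≤ countFin n q
countFin-mono zero    p q p⇒q = z≤n
countFin-mono (suc n) p q p⇒q with p zero in p0 | q zero in q0
... | true  | true  = s≤s (countFin-mono n (p ∘ suc) (q ∘ suc) (p⇒q ∘ suc))
... | true  | false = ⊥-elim (true≢false (p⇒q zero p0) q0)
... | false | true  = ≤-trans (countFin-mono n (p ∘ suc) (q ∘ suc) (p⇒q ∘ suc)) (n≤1+n _)
... | false | false = countFin-mono n (p ∘ suc) (q ∘ suc) (p⇒q ∘ suc)

countFin-strict : ∀ n (p q : Fin n → Bool) → (∀ i → p i ≡ true → q i ≡ true) →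
  (i : Fin n) → p i ≡ false → q i ≡ true → countFin n p < countFin n q
countFin-strict (suc n) p q p⇒q zero pi qi rewrite pi | qi =
  s≤s (countFin-mono n (p ∘ suc) (q ∘ suc) (p⇒q ∘ suc))
countFin-strict (suc n) p q p⇒q (suc i) pi qi with p zero in p0 | q zero in q0
... | true  | true  = s≤s (countFin-strict n (p ∘ suc) (q ∘ suc) (p⇒q ∘ suc) i pi qi)
... | true  | false = ⊥-elim (true≢false (p⇒q zero p0) q0)
... | false | true  = ≤-trans (countFin-strict n (p ∘ suc) (q ∘ suc) (p⇒q ∘ suc) i pi qi) (n≤1+n _)
... | false | false = countFin-strict n (p ∘ suc) (q ∘ suc) (p⇒q ∘ suc) i pi qi

countFin-≤ : ∀ n (p : Fin n → Bool) → countFin n p ≤ n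
countFin-≤ zero    p = z≤n
countFin-≤ (suc n) p with p zero
... | true  = s≤s (countFin-≤ n (p ∘ suc))
... | false = ≤-trans (countFin-≤ n (p ∘ suc)) (n≤1+n n)

predFin : ∀ {n} (i : Fin (suc n)) → i ≢ zero → Fin n
predFin zero    i≢0 = ⊥-elim (i≢0 refl)
predFin (suc i) _   = i

suc-predFin : ∀ {n} (i : Fin (suc n)) (i≢0 : i ≢ zero) → suc (predFin i i≢0) ≡ i
suc-predFin zero    i≢0 = ⊥-elim (i≢0 refl)
suc-predFin (suc i) _   = refl

lower : ∀ {m n} (g : Fin m → Fin (suc n)) → (∀ j → g j ≢ zero) → Fin m → Fin n
lower g avoids j = predFin (g j) (avoids j)

suc-lower : ∀ {m n} (g : Fin m → Fin (suc n)) avoids j → suc (lower g avoids j) ≡ g j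
suc-lower g avoids j = suc-predFin (g j) (avoids j)

lower-injective : ∀ {m n} (g : Fin m → Fin (suc n)) avoids → (∀ i j → g i ≡ g j → i ≡ j) →
  ∀ i j → lower g avoids i ≡ lower g avoids j → i ≡ j
lower-injective g avoids g-inj i j eq =
  g-inj i j (trans (sym (suc-lower g avoids i)) (trans (cong suc eq) (suc-lower g avoids j)))

injection⇒≤countFin : ∀ n m (p : Fin n → Bool) (g : Fin m → Fin n) →
  (∀ i j → g i ≡ g j → i ≡ j) → (∀ i → p (g i) ≡ true) → m ≤ countFin n p
injection⇒≤countFin n       zero    p g g-inj pg = z≤n
injection⇒≤countFin zero    (suc m) p g g-inj pg with () ← g zero
injection⇒≤countFin (suc n) (suc m) p g g-inj pg with any? (λ i → g i ≟ zero)
-- zero is hit, at i: it is counted, and g without i lands in the tail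
... | yes (i , gi≡0) rewrite trans (cong p (sym gi≡0)) (pg i) =
  s≤s (injection⇒≤countFin n m (p ∘ suc) (lower g′ avoids) (lower-injective g′ avoids g′-inj)
         (λ j → trans (cong p (suc-lower g′ avoids j)) (pg _)))
  where
  g′ : Fin m → Fin (suc n)
  g′ = g ∘ punchIn i
  g′-inj : ∀ j k → g′ j ≡ g′ k → j ≡ k
  g′-inj j k eq = punchIn-injective i j k (g-inj _ _ eq)
  avoids : ∀ j → g′ j ≢ zero
  avoids j g≡0 = punchInᵢ≢i i j (g-inj _ _ (trans g≡0 (sym gi≡0)))
-- zero is not hit: the whole injection lands in the tail
... | no ¬hit = ≤-trans
  (injection⇒≤countFin n (suc m) (p ∘ suc) (lower g avoids) (lower-injective g avoids g-inj)
     (λ j → trans (cong p (suc-lower g avoids j)) (pg _)))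
  (m≤n+m _ _)
  where
  avoids : ∀ j → g j ≢ zero
  avoids j g≡0 = ¬hit (j , g≡0)

sumFin-mono : ∀ n (f g : Fin n → ℕ) → (∀ i → f i ≤ g i) → sumFin n f ≤ sumFin n g
sumFin-mono zero    f g f≤g = z≤n
sumFin-mono (suc n) f g f≤g = +-mono-≤ (f≤g zero) (sumFin-mono n (f ∘ suc) (g ∘ suc) (f≤g ∘ suc))

anyFin-witness : ∀ n (p : Fin n → Bool) i → p i ≡ true → anyFin n p ≡ true
anyFin-witness (suc n) p zero    pi rewrite pi = refl
anyFin-witness (suc n) p (suc i) pi with p zero
... | true  = refl
... | false = anyFin-witness n (p ∘ suc) i pi

anyFin-none : ∀ n (p : Fin n → Bool) i → anyFin n p ≡ false → p i ≡ false
anyFin-none n p i none with p i in pi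
... | true  = ⊥-elim (true≢false (anyFin-witness n p i pi) none)
... | false = refl

weakCount-mono : ∀ {n} (G₁ G₂ : Graph n) c (l₁ l₂ : Fin n → Fin n → Maybe (Fin c)) →
  (∀ u v → adj G₁ u v ≡ true → is-nothing (l₁ u v) ≡ true → adj G₂ u v ∧ is-nothing (l₂ u v) ≡ true) →
  weakCount G₁ c l₁ ≤ weakCount G₂ c l₂
weakCount-mono {n} G₁ G₂ c l₁ l₂ weak⇒weak = sumFin-mono n _ _ λ u → countFin-mono n _ _ λ v counted →
  let u<v = toℕ u <ᵇ toℕ v
      rest = ∧-true-r {u<v} counted
  in ∧-true (∧-true-l {u<v} counted) (weak⇒weak u v (∧-true-l {adj G₁ u v} rest) (∧-true-r {adj G₁ u v} rest))

-- The library transposition of two elements of Fin n and its basic behaviour;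
-- it is the colour interchange of a Kempe chain.

transpose-matchˡ : ∀ {n} (i j : Fin n) → transpose i j i ≡ j
transpose-matchˡ i j rewrite dec-true (i ≟ i) refl = refl

transpose-matchʳ : ∀ {n} (i j : Fin n) → transpose i j j ≡ i
transpose-matchʳ i j with j ≟ i
... | yes j≡i = j≡i
... | no j≢i rewrite dec-true (j ≟ j) refl = refl

transpose-other : ∀ {n} (i j k : Fin n) → k ≢ i → k ≢ j → transpose i j k ≡ k
transpose-other i j k k≢i k≢j rewrite dec-false (k ≟ i) k≢i | dec-false (k ≟ j) k≢j = refl

transpose-involutive : ∀ {n} (i j k : Fin n) → transpose i j (transpose i j k) ≡ k
transpose-involutive i j k = cases (k ≟ i) (k ≟ j)
  where
  cases : Dec (k ≡ i) → Dec (k ≡ j) → transpose i j (transpose i j k) ≡ k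
  cases (yes refl) _ = trans (cong (transpose k j) (transpose-matchˡ k j)) (transpose-matchʳ k j)
  cases (no _) (yes refl) = trans (cong (transpose i k) (transpose-matchʳ i k)) (transpose-matchˡ i k)
  cases (no k≢i) (no k≢j) =
    trans (cong (transpose i j) (transpose-other i j k k≢i k≢j)) (transpose-other i j k k≢i k≢j)

module PartialColouring {n : ℕ} (c : ℕ) (H : Fin n → Fin n → Bool)
  (H-sym : ∀ u v → H u v ≡ H v u) (H-irrefl : ∀ v → H v v ≡ false) where

  open import Data.List.Membership.DecPropositional (_≟_ {n}) using (_∈?_)

  Colouring : Set
  Colouring = Fin n → Fin n → Maybe (Fin c)

  record Good (φ : Colouring) : Set where
    field
      symmetric : ∀ u v → φ u v ≡ φ v u
      supported : ∀ u v i → φ u v ≡ just i → H u v ≡ true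
      proper    : ∀ u v w i → φ u v ≡ just i → φ u w ≡ just i → v ≡ w
  open Good public

  _⊒_ : Colouring → Colouring → Set
  φ′ ⊒ φ = ∀ u v → φ′ u v ≡ nothing → φ u v ≡ nothing

  ⊒-trans : ∀ {φ″ φ′ φ} → φ″ ⊒ φ′ → φ′ ⊒ φ → φ″ ⊒ φ
  ⊒-trans φ″⊒φ′ φ′⊒φ u v uncoloured = φ′⊒φ u v (φ″⊒φ′ u v uncoloured)

  H-distinct : ∀ {u v} → H u v ≡ true → u ≢ v
  H-distinct {u} Huv refl = true≢false Huv (H-irrefl u)

  Missing : Colouring → Fin n → Fin c → Set
  Missing φ v γ = ∀ w → φ v w ≢ just γ

  _≟M_ : (a b : Maybe (Fin c)) → Dec (a ≡ b)
  _≟M_ = ≡-dec-Maybe _≟_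

  missing? : ∀ φ v γ → Dec (Missing φ v γ)
  missing? φ v γ with all? (λ w → ¬? (φ v w ≟M just γ))
  ... | yes none = yes none
  ... | no ¬none = no ¬none

  present : ∀ φ v γ → ¬ Missing φ v γ → Σ (Fin n) λ w → φ v w ≡ just γ
  present φ v γ ¬missing with any? (λ w → φ v w ≟M just γ)
  ... | yes found = found
  ... | no ¬found = ⊥-elim (¬missing (λ w eq → ¬found (w , eq)))

  deg : Fin n → ℕ
  deg v = countFin n (H v)

  -- A vertex of degree below c misses some colour: otherwise the c colours
  -- at v would sit on c distinct edges of H at v.
  missing-colour : ∀ φ → Good φ → ∀ v → deg v < c → Σ (Fin c) (Missing φ v)
  missing-colour φ good v deg<c with any? (missing? φ v)
  ... | yes found = found
  ... | no ¬found = ⊥-elim (<-irrefl refl (<-≤-trans deg<c c≤deg))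
    where
    nbr : Fin c → Fin n
    nbr γ = proj₁ (present φ v γ (λ m → ¬found (γ , m)))
    nbr-colour : ∀ γ → φ v (nbr γ) ≡ just γ
    nbr-colour γ = proj₂ (present φ v γ (λ m → ¬found (γ , m)))
    nbr-injective : ∀ γ δ → nbr γ ≡ nbr δ → γ ≡ δ
    nbr-injective γ δ eq = just-injective (trans (sym (nbr-colour γ)) (trans (cong (φ v) eq) (nbr-colour δ)))
    c≤deg : c ≤ deg v
    c≤deg = injection⇒≤countFin n c (H v) nbr nbr-injective (λ γ → supported good v (nbr γ) γ (nbr-colour γ))

  SameEdge : Fin n → Fin n → Fin n → Fin n → Set
  SameEdge a b u v = (u ≡ a × v ≡ b) ⊎ (u ≡ b × v ≡ a)

  sameEdge? : ∀ a b u v → Dec (SameEdge a b u v)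
  sameEdge? a b u v = (u ≟ a ×-dec v ≟ b) ⊎-dec (u ≟ b ×-dec v ≟ a)

  sameEdge-flip : ∀ {a b u v} → SameEdge a b u v → SameEdge a b v u
  sameEdge-flip (inj₁ (u≡a , v≡b)) = inj₂ (v≡b , u≡a)
  sameEdge-flip (inj₂ (u≡b , v≡a)) = inj₁ (v≡a , u≡b)

  recolour : Colouring → Fin n → Fin n → Maybe (Fin c) → Colouring
  recolour φ a b m u v with sameEdge? a b u v
  ... | yes _ = m
  ... | no  _ = φ u v

  recolour-on : ∀ φ a b m {u v} → SameEdge a b u v → recolour φ a b m u v ≡ m
  recolour-on φ a b m {u} {v} same with sameEdge? a b u v
  ... | yes _     = refl
  ... | no ¬same = ⊥-elim (¬same same)

  recolour-off : ∀ φ a b m {u v} → ¬ SameEdge a b u v → recolour φ a b m u v ≡ φ u v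
  recolour-off φ a b m {u} {v} ¬same with sameEdge? a b u v
  ... | yes same = ⊥-elim (¬same same)
  ... | no _     = refl

  recolour-⊒ : ∀ φ a b δ → recolour φ a b (just δ) ⊒ φ
  recolour-⊒ φ a b δ u v uncoloured with sameEdge? a b u v
  ... | no _ = uncoloured

  not-sameEdge-vertex : ∀ {a b u v} → u ≢ a → u ≢ b → ¬ SameEdge a b u v
  not-sameEdge-vertex u≢a _ (inj₁ (u≡a , _)) = u≢a u≡a
  not-sameEdge-vertex _ u≢b (inj₂ (u≡b , _)) = u≢b u≡b

  not-sameEdge-end : ∀ {a b u v} → u ≢ b → v ≢ b → ¬ SameEdge a b u v
  not-sameEdge-end _ v≢b (inj₁ (_ , v≡b)) = v≢b v≡b
  not-sameEdge-end u≢b _ (inj₂ (u≡b , _)) = u≢b u≡b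

  recolour-missing-away : ∀ φ a b m {u γ} → u ≢ a → u ≢ b → Missing φ u γ → Missing (recolour φ a b m) u γ
  recolour-missing-away φ a b m u≢a u≢b miss w eq =
    miss w (trans (sym (recolour-off φ a b m (not-sameEdge-vertex u≢a u≢b))) eq)

  good-recolour : ∀ φ a b δ → Good φ → H a b ≡ true → Missing φ a δ → Missing φ b δ →
    Good (recolour φ a b (just δ))
  good-recolour φ a b δ good Hab miss-a miss-b = record
    { symmetric = symm ; supported = supp ; proper = prop }
    where
    φ′ : Colouring
    φ′ = recolour φ a b (just δ)

    endpoint-missing : ∀ {u v} → SameEdge a b u v → Missing φ u δ
    endpoint-missing (inj₁ (refl , _)) = miss-a
    endpoint-missing (inj₂ (refl , _)) = miss-b

    symm : ∀ u v → φ′ u v ≡ φ′ v u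
    symm u v with sameEdge? a b u v
    ... | yes same = sym (recolour-on φ a b _ (sameEdge-flip same))
    ... | no ¬same = trans (symmetric good u v) (sym (recolour-off φ a b _ (¬same ∘ sameEdge-flip)))

    supp : ∀ u v i → φ′ u v ≡ just i → H u v ≡ true
    supp u v i eq with sameEdge? a b u v
    ... | yes (inj₁ (refl , refl)) = Hab
    ... | yes (inj₂ (refl , refl)) = trans (H-sym b a) Hab
    ... | no _ = supported good u v i eq

    clash : ∀ {u v w i} → SameEdge a b u v → ¬ SameEdge a b u w →
      φ′ u v ≡ just i → φ′ u w ≡ just i → ⊥
    clash {u} {v} {w} same ¬same eq₁ eq₂ = endpoint-missing same w
      (trans (sym (recolour-off φ a b _ ¬same)) (trans eq₂ (trans (sym eq₁) (recolour-on φ a b _ same))))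

    prop : ∀ u v w i → φ′ u v ≡ just i → φ′ u w ≡ just i → v ≡ w
    prop u v w i eq₁ eq₂ = decide (sameEdge? a b u v) (sameEdge? a b u w)
      where
      decide : Dec (SameEdge a b u v) → Dec (SameEdge a b u w) → v ≡ w
      decide (yes (inj₁ (_ , v≡b)))   (yes (inj₁ (_ , w≡b)))   = trans v≡b (sym w≡b)
      decide (yes (inj₂ (_ , v≡a)))   (yes (inj₂ (_ , w≡a)))   = trans v≡a (sym w≡a)
      decide (yes (inj₁ (u≡a , _)))   (yes (inj₂ (u≡b , _)))   = ⊥-elim (H-distinct Hab (trans (sym u≡a) u≡b))
      decide (yes (inj₂ (u≡b , _)))   (yes (inj₁ (u≡a , _)))   = ⊥-elim (H-distinct Hab (trans (sym u≡a) u≡b))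
      decide (yes same) (no ¬same) = ⊥-elim (clash same ¬same eq₁ eq₂)
      decide (no ¬same) (yes same) = ⊥-elim (clash same ¬same eq₂ eq₁)
      decide (no ¬same₁) (no ¬same₂) = proper good u v w i
        (trans (sym (recolour-off φ a b _ ¬same₁)) eq₁) (trans (sym (recolour-off φ a b _ ¬same₂)) eq₂)

  module Interchange (α β : Fin c) where

    τ : Fin c → Fin c
    τ = transpose α β

    flipColour : Maybe (Fin c) → Maybe (Fin c)
    flipColour = mapMaybe τ

    flipColour-move : ∀ m m′ → flipColour m ≡ m′ → m ≡ flipColour m′
    flipColour-move nothing  _ refl = refl
    flipColour-move (just γ) _ refl = cong just (sym (transpose-involutive α β γ))

    flipColour-other : ∀ m → m ≢ just α → m ≢ just β → flipColour m ≡ m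
    flipColour-other nothing  _   _   = refl
    flipColour-other (just γ) m≢α m≢β = cong just (transpose-other α β γ (m≢α ∘ cong just) (m≢β ∘ cong just))

    ChainEdge : Colouring → Fin n → Fin n → Set
    ChainEdge φ u v = (φ u v ≡ just α) ⊎ (φ u v ≡ just β)

    chainEdge? : ∀ φ u v → Dec (ChainEdge φ u v)
    chainEdge? φ u v = (φ u v ≟M just α) ⊎-dec (φ u v ≟M just β)

    chainEdge-flip : ∀ {φ} → Good φ → ∀ {u v} → ChainEdge φ u v → ChainEdge φ v u
    chainEdge-flip good {u} {v} (inj₁ eq) = inj₁ (trans (symmetric good v u) eq)
    chainEdge-flip good {u} {v} (inj₂ eq) = inj₂ (trans (symmetric good v u) eq)

    Closed : Colouring → (Fin n → Bool) → Set
    Closed φ W = ∀ u v → W u ≡ true → ChainEdge φ u v → W v ≡ true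

    interchange : (Fin n → Bool) → Colouring → Colouring
    interchange W φ u v with W u
    ... | true  = φ u v
    ... | false = flipColour (φ u v)

    interchange-inside : ∀ W φ u v → W u ≡ true → interchange W φ u v ≡ φ u v
    interchange-inside W φ u v Wu with W u
    ... | true = refl

    interchange-outside : ∀ W φ u v → W u ≡ false → interchange W φ u v ≡ flipColour (φ u v)
    interchange-outside W φ u v Wu with W u
    ... | false = refl

    interchange-⊒ : ∀ W φ → interchange W φ ⊒ φ
    interchange-⊒ W φ u v uncoloured with W u
    ... | true  = uncoloured
    ... | false = flipColour-move _ _ uncoloured

    -- Across the boundary of a closed W there are no α/β-edges, so the
    -- interchange stays symmetric; at each vertex it permutes colours.
    good-interchange : ∀ φ W → Good φ → Closed φ W → Good (interchange W φ)
    good-interchange φ W good closed = record { symmetric = symm ; supported = supp ; proper = prop }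
      where
      φ′ : Colouring
      φ′ = interchange W φ

      boundary : ∀ u v → W u ≡ true → W v ≡ false → φ u v ≡ flipColour (φ v u)
      boundary u v Wu Wv = sym (trans (cong flipColour (symmetric good v u))
        (flipColour-other _ (λ eq → true≢false (closed u v Wu (inj₁ eq)) Wv)
                            (λ eq → true≢false (closed u v Wu (inj₂ eq)) Wv)))

      symm : ∀ u v → φ′ u v ≡ φ′ v u
      symm u v with W u in Wu | W v in Wv
      ... | true  | true  = symmetric good u v
      ... | false | false = cong flipColour (symmetric good u v)
      ... | true  | false = boundary u v Wu Wv
      ... | false | true  = sym (boundary v u Wv Wu)

      supp : ∀ u v i → φ′ u v ≡ just i → H u v ≡ true
      supp u v i eq with W u
      ... | true = supported good u v i eq
      ... | false with φ u v in coloured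
      ...   | just j = supported good u v j coloured

      prop : ∀ u v w i → φ′ u v ≡ just i → φ′ u w ≡ just i → v ≡ w
      prop u v w i eq₁ eq₂ with W u
      ... | true  = proper good u v w i eq₁ eq₂
      ... | false = proper good u v w (τ i) (flipColour-move _ _ eq₁) (flipColour-move _ _ eq₂)

    interchange-missing : ∀ W φ a γ → (W a ≡ false → γ ≢ α × γ ≢ β) →
      Missing φ a γ → Missing (interchange W φ) a γ
    interchange-missing W φ a γ outside⇒other miss w eq with W a
    ... | true  = miss w eq
    ... | false = miss w (trans (flipColour-move _ _ eq)
                     (cong just (transpose-other α β γ (proj₁ (outside⇒other refl)) (proj₂ (outside⇒other refl)))))

    interchange-missing-β : ∀ W φ a → W a ≡ false → Missing φ a β → Missing (interchange W φ) a α
    interchange-missing-β W φ a Wa miss w eq =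
      miss w (trans (flipColour-move _ _ (trans (sym (interchange-outside W φ a w Wa)) eq)) (cong just (transpose-matchˡ α β)))

    module KempeChain (φ : Colouring) (good : Good φ) (x : Fin n) (x-misses-α : Missing φ x α) where

      -- A closed set W containing x in which, apart from x, at most one
      -- vertex misses β (x misses α, so the chain is a path from x).
      record Chain : Set where
        field
          W          : Fin n → Bool
          contains-x : W x ≡ true
          closed     : Closed φ W
          one-end    : ∀ a b → W a ≡ true → W b ≡ true → a ≢ x → b ≢ x →
                       Missing φ a β → Missing φ b β → a ≡ b

      two-chain-edges : ∀ e p u v → ChainEdge φ e p → ChainEdge φ e u → p ≢ u →
        ChainEdge φ e v → (v ≡ p) ⊎ (v ≡ u)
      two-chain-edges e p u v (inj₁ ep) (inj₁ eu) p≢u _ = ⊥-elim (p≢u (proper good e p u α ep eu))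
      two-chain-edges e p u v (inj₂ ep) (inj₂ eu) p≢u _ = ⊥-elim (p≢u (proper good e p u β ep eu))
      two-chain-edges e p u v (inj₁ ep) (inj₂ eu) _ (inj₁ ev) = inj₁ (proper good e v p α ev ep)
      two-chain-edges e p u v (inj₁ ep) (inj₂ eu) _ (inj₂ ev) = inj₂ (proper good e v u β ev eu)
      two-chain-edges e p u v (inj₂ ep) (inj₁ eu) _ (inj₁ ev) = inj₂ (proper good e v u α ev eu)
      two-chain-edges e p u v (inj₂ ep) (inj₁ eu) _ (inj₂ ev) = inj₁ (proper good e v p β ev ep)

      two-chain-edges-β : ∀ e p u → ChainEdge φ e p → ChainEdge φ e u → p ≢ u →
        Σ (Fin n) λ w → φ e w ≡ just β
      two-chain-edges-β e p u (inj₂ ep) _         _   = p , ep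
      two-chain-edges-β e p u (inj₁ _)  (inj₂ eu) _   = u , eu
      two-chain-edges-β e p u (inj₁ ep) (inj₁ eu) p≢u = ⊥-elim (p≢u (proper good e p u α ep eu))

      x-chain-edge-β : ∀ v → ChainEdge φ x v → φ x v ≡ just β
      x-chain-edge-β v (inj₁ xv) = ⊥-elim (x-misses-α v xv)
      x-chain-edge-β v (inj₂ xv) = xv

      separated : ∀ (W : Fin n → Bool) {p u} → W p ≡ true → W u ≡ false → p ≢ u
      separated W Wp Wu refl = true≢false Wp Wu

      record Path : Set where
        field
          W              : Fin n → Bool
          end            : Fin n
          contains-x     : W x ≡ true
          contains-end   : W end ≡ true
          closed-but-end : ∀ u v → W u ≡ true → u ≢ end → ChainEdge φ u v → W v ≡ true
          inner-sees-β   : ∀ u → W u ≡ true → u ≢ x → u ≢ end → Σ (Fin n) λ w → φ u w ≡ just β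
          entered        : (end ≡ x) ⊎ (Σ (Fin n) λ p → W p ≡ true × p ≢ end × ChainEdge φ end p)

      insert : (Fin n → Bool) → Fin n → Fin n → Bool
      insert W u v with v ≟ u
      ... | yes _ = true
      ... | no  _ = W v

      insert-old : ∀ W u v → W v ≡ true → insert W u v ≡ true
      insert-old W u v Wv with v ≟ u
      ... | yes _ = refl
      ... | no  _ = Wv

      insert-new : ∀ W u → insert W u u ≡ true
      insert-new W u with u ≟ u
      ... | yes _   = refl
      ... | no  u≢u = ⊥-elim (u≢u refl)

      insert-inv : ∀ W u v → insert W u v ≡ true → (W v ≡ true) ⊎ (v ≡ u)
      insert-inv W u v inserted with v ≟ u
      ... | yes v≡u = inj₂ v≡u
      ... | no  _   = inj₁ inserted

      start : Path
      start = record
        { W = insert (λ _ → false) x ; end = x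
        ; contains-x = insert-new _ x ; contains-end = insert-new _ x
        ; closed-but-end = λ u _ Wu u≢x _ → ⊥-elim (u≢x (only-x u Wu))
        ; inner-sees-β = λ u Wu u≢x _ → ⊥-elim (u≢x (only-x u Wu))
        ; entered = inj₁ refl }
        where
        only-x : ∀ u → insert (λ _ → false) x u ≡ true → u ≡ x
        only-x u Wu with insert-inv (λ _ → false) x u Wu
        ... | inj₂ u≡x = u≡x

      finish : (s : Path) → (∀ v → ChainEdge φ (Path.end s) v → Path.W s v ≡ true) → Chain
      finish s end-closed = record
        { W = W ; contains-x = contains-x ; closed = closed′ ; one-end = one-end′ }
        where
        open Path s
        closed′ : Closed φ W
        closed′ a v Wa edge with a ≟ end
        ... | yes refl  = end-closed v edge
        ... | no  a≢end = closed-but-end a v Wa a≢end edge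
        is-end : ∀ a → W a ≡ true → a ≢ x → Missing φ a β → a ≡ end
        is-end a Wa a≢x miss with a ≟ end
        ... | yes a≡end = a≡end
        ... | no  a≢end = ⊥-elim (miss _ (proj₂ (inner-sees-β a Wa a≢x a≢end)))
        one-end′ : ∀ a b → W a ≡ true → W b ≡ true → a ≢ x → b ≢ x → Missing φ a β → Missing φ b β → a ≡ b
        one-end′ a b Wa Wb a≢x b≢x miss-a miss-b = trans (is-end a Wa a≢x miss-a) (sym (is-end b Wb b≢x miss-b))

      extend : (s : Path) → ∀ u → ChainEdge φ (Path.end s) u → Path.W s u ≡ false → Path
      extend s u end–u Wu = record
        { W = insert W u ; end = u
        ; contains-x = insert-old W u x contains-x ; contains-end = insert-new W u
        ; closed-but-end = closed′ ; inner-sees-β = inner′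
        ; entered = inj₂ (end , insert-old W u end contains-end , separated W contains-end Wu
                         , chainEdge-flip good end–u) }
        where
        open Path s
        old-end-edges : ∀ v → ChainEdge φ end v → (W v ≡ true) ⊎ (v ≡ u)
        old-end-edges v end–v with entered
        ... | inj₁ refl = inj₂ (proper good end v u β (x-chain-edge-β v end–v) (x-chain-edge-β u end–u))
        ... | inj₂ (p , Wp , _ , end–p) with two-chain-edges end p u v end–p end–u (separated W Wp Wu) end–v
        ...   | inj₁ refl = inj₁ Wp
        ...   | inj₂ v≡u  = inj₂ v≡u
        closed′ : ∀ a v → insert W u a ≡ true → a ≢ u → ChainEdge φ a v → insert W u v ≡ true
        closed′ a v Wa a≢u edge with insert-inv W u a Wa
        ... | inj₂ a≡u = ⊥-elim (a≢u a≡u)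
        ... | inj₁ Wa′ with a ≟ end
        ...   | no a≢end = insert-old W u v (closed-but-end a v Wa′ a≢end edge)
        ...   | yes refl with old-end-edges v edge
        ...     | inj₁ Wv   = insert-old W u v Wv
        ...     | inj₂ refl = insert-new W u
        inner′ : ∀ a → insert W u a ≡ true → a ≢ x → a ≢ u → Σ (Fin n) λ w → φ a w ≡ just β
        inner′ a Wa a≢x a≢u with insert-inv W u a Wa
        ... | inj₂ a≡u = ⊥-elim (a≢u a≡u)
        ... | inj₁ Wa′ with a ≟ end
        ...   | no a≢end = inner-sees-β a Wa′ a≢x a≢end
        ...   | yes refl with entered
        ...     | inj₁ a≡x = ⊥-elim (a≢x a≡x)
        ...     | inj₂ (p , Wp , _ , a–p) = two-chain-edges-β a p u a–p end–u (separated W Wp Wu)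

      -- termination measure: each extension visits a new vertex
      unvisited : Path → ℕ
      unvisited s = countFin n (not ∘ Path.W s)

      extend-shrinks : ∀ s u end–u Wu → unvisited (extend s u end–u Wu) < unvisited s
      extend-shrinks s u end–u Wu = countFin-strict n _ _ stays u (cong not (insert-new W u)) (cong not Wu)
        where
        open Path s
        stays : ∀ v → not (insert W u v) ≡ true → not (W v) ≡ true
        stays v outside with W v in Wv
        ... | false = refl
        ... | true with () ← trans (cong not (sym (insert-old W u v Wv))) outside

      grow : (fuel : ℕ) (s : Path) → unvisited s ≤ fuel → Chain
      grow fuel s bound with any? (λ v → chainEdge? φ (Path.end s) v ×-dec (Path.W s v ≟B false))
      ... | no none = finish s end-closed
        where
        end-closed : ∀ v → ChainEdge φ (Path.end s) v → Path.W s v ≡ true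
        end-closed v edge with Path.W s v in Wv
        ... | true  = refl
        ... | false = ⊥-elim (none (v , edge , Wv))
      ... | yes (u , end–u , Wu) with fuel
      ...   | zero with () ← <-≤-trans (extend-shrinks s u end–u Wu) bound
      ...   | suc fuel′ = grow fuel′ (extend s u end–u Wu) (≤-pred (<-≤-trans (extend-shrinks s u end–u Wu) bound))

      chain : Chain
      chain = grow _ start ≤-refl

  record Extension (φ : Colouring) (x y : Fin n) : Set where
    field
      colouring : Colouring
      is-good   : Good colouring
      colours   : Σ (Fin c) λ i → colouring x y ≡ just i
      extends   : colouring ⊒ φ

  extension-via : ∀ {φ′ φ x y} → φ′ ⊒ φ → Extension φ′ x y → Extension φ x y
  extension-via φ′⊒φ ext = record
    { colouring = colouring ; is-good = is-good ; colours = colours ; extends = ⊒-trans extends φ′⊒φ }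
    where open Extension ext

  extension-flip : ∀ {φ x y} → Extension φ y x → Extension φ x y
  extension-flip ext = record
    { colouring = colouring ; is-good = is-good ; extends = extends
    ; colours = proj₁ colours , trans (symmetric is-good _ _) (proj₂ colours) }
    where open Extension ext

  data Precedes (b a : Fin n) : List (Fin n) → Set where
    at-head : ∀ {l} → Precedes b a (b ∷ a ∷ l)
    further : ∀ {z l} → Precedes b a l → Precedes b a (z ∷ l)

  precedes-∈ˡ : ∀ {b a l} → Precedes b a l → b ∈ l
  precedes-∈ˡ at-head      = here refl
  precedes-∈ˡ (further pr) = there (precedes-∈ˡ pr)

  precedes-∈ʳ : ∀ {b a l} → Precedes b a l → a ∈ l
  precedes-∈ʳ at-head      = there (here refl)
  precedes-∈ʳ (further pr) = there (precedes-∈ʳ pr)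

  precedes-∈-tail : ∀ {b a y t} → Precedes b a (y ∷ t) → a ∈ t
  precedes-∈-tail at-head      = here refl
  precedes-∈-tail (further pr) = precedes-∈ʳ pr

  -- Fans at x for the uncoloured edge x y₀ (Vizing): a list z ∷ … ∷ y₀ of
  -- distinct neighbours of x, newest first, in which the colour of each edge
  -- x z is missing at the vertex following z.
  module Fans (x y₀ : Fin n) where

    data Fan (φ : Colouring) : List (Fin n) → Set where
      base : H x y₀ ≡ true → φ x y₀ ≡ nothing → Fan φ (y₀ ∷ [])
      step : ∀ {y ys} z γ → Fan φ (y ∷ ys) → z ∉ y ∷ ys → φ x z ≡ just γ → Missing φ y γ →
             Fan φ (z ∷ y ∷ ys)

    fan-adjacent : ∀ {φ ys v} → Good φ → Fan φ ys → v ∈ ys → H x v ≡ true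
    fan-adjacent good (base Hxy₀ _)       (here refl) = Hxy₀
    fan-adjacent good (step z γ _ _ xz _) (here refl) = supported good x z γ xz
    fan-adjacent good (step _ _ fan _ _ _) (there v∈) = fan-adjacent good fan v∈

    fan-head-fresh : ∀ {φ a t} → Fan φ (a ∷ t) → a ∉ t
    fan-head-fresh (base _ _)            ()
    fan-head-fresh (step _ _ _ fresh _ _) = fresh

    fan-successor-unique : ∀ {φ ys b a a′} → Fan φ ys → Precedes b a ys → Precedes b a′ ys → a ≡ a′
    fan-successor-unique (step _ _ _ _ _ _)     at-head       at-head       = refl
    fan-successor-unique (step _ _ _ fresh _ _) at-head       (further pr)  = ⊥-elim (fresh (precedes-∈ˡ pr))
    fan-successor-unique (step _ _ _ fresh _ _) (further pr)  at-head       = ⊥-elim (fresh (precedes-∈ˡ pr))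
    fan-successor-unique (step _ _ fan _ _ _)   (further pr₁) (further pr₂) = fan-successor-unique fan pr₁ pr₂
    fan-successor-unique (base _ _)             (further ())  _

    fan-transport : ∀ {φ φ′ ys} → Fan φ ys → (∀ v → v ∈ ys → φ′ x v ≡ φ x v) →
      (∀ a b γ → Precedes b a ys → φ x b ≡ just γ → Missing φ a γ → Missing φ′ a γ) → Fan φ′ ys
    fan-transport (base Hxy₀ uncoloured) same-at-x same-missing =
      base Hxy₀ (trans (same-at-x _ (here refl)) uncoloured)
    fan-transport (step z γ fan fresh xz miss) same-at-x same-missing =
      step z γ (fan-transport fan (λ v v∈ → same-at-x v (there v∈)) (λ a b γ′ pr → same-missing a b γ′ (further pr)))
        fresh (trans (same-at-x z (here refl)) xz) (same-missing _ z γ at-head xz miss)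

    record SuccessorOf (φ : Colouring) (ys : List (Fin n)) (z : Fin n) (β : Fin c) : Set where
      field
        a            : Fin n
        rest         : List (Fin n)
        sub-fan      : Fan φ (a ∷ rest)
        z-precedes-a : Precedes z a ys
        a-misses-β   : Missing φ a β
        z∉sub-fan    : z ∉ a ∷ rest

    successor-of : ∀ {φ ys z β} → Fan φ ys → z ∈ ys → φ x z ≡ just β → SuccessorOf φ ys z β
    successor-of (base _ uncoloured) (here refl) xz with () ← trans (sym uncoloured) xz
    successor-of (step z γ fan fresh xz miss) (here refl) xz′ with just-injective (trans (sym xz) xz′)
    ... | refl = record { a = _ ; rest = _ ; sub-fan = fan ; z-precedes-a = at-head
                        ; a-misses-β = miss ; z∉sub-fan = fresh }
    successor-of (step _ _ fan _ _ _) (there z∈) xz = record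
      { a = a ; rest = rest ; sub-fan = sub-fan ; z-precedes-a = further z-precedes-a
      ; a-misses-β = a-misses-β ; z∉sub-fan = z∉sub-fan }
      where open SuccessorOf (successor-of fan z∈ xz)

    -- Rotating the fan: if its head and x both miss δ, shift every colour one
    -- step towards y₀, which colours x y₀.
    rotate : ∀ {y ys} φ δ → Good φ → Fan φ (y ∷ ys) → Missing φ y δ → Missing φ x δ → Extension φ x y₀
    rotate φ δ good (base Hxy₀ _) y₀-misses x-misses = record
      { colouring = recolour φ x y₀ (just δ)
      ; is-good = good-recolour φ x y₀ δ good Hxy₀ x-misses y₀-misses
      ; colours = δ , recolour-on φ x y₀ _ (inj₁ (refl , refl))
      ; extends = recolour-⊒ φ x y₀ δ }
    rotate φ δ good (step {y} z γ fan fresh xz y-misses-γ) z-misses x-misses =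
      extension-via (recolour-⊒ φ x z δ) (rotate φ₁ γ good₁ fan₁ y-misses-γ₁ x-misses-γ₁)
      where
      Hxz : H x z ≡ true
      Hxz = supported good x z γ xz
      x≢z : x ≢ z
      x≢z = H-distinct Hxz
      -- give x z the colour δ; then x misses γ, which y also misses
      φ₁ : Colouring
      φ₁ = recolour φ x z (just δ)
      good₁ : Good φ₁
      good₁ = good-recolour φ x z δ good Hxz x-misses z-misses
      away : ∀ {v} → v ∈ _ → v ≢ x × v ≢ z
      away v∈ = (λ v≡x → H-distinct (fan-adjacent good fan v∈) (sym v≡x))
              , (λ v≡z → fresh (subst (_∈ _) v≡z v∈))
      x-misses-γ₁ : Missing φ₁ x γ
      x-misses-γ₁ w eq = cases (w ≟ z)
        where
        -- x z now has colour δ ≠ γ, and the other edges at x kept their colours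
        cases : Dec (w ≡ z) → ⊥
        cases (yes refl) = x-misses z (trans xz (trans (sym eq) (recolour-on φ x z _ (inj₁ (refl , refl)))))
        cases (no w≢z) = w≢z (proper good x w z γ (trans (sym (recolour-off φ x z _ (not-sameEdge-end x≢z w≢z))) eq) xz)
      y-misses-γ₁ : Missing φ₁ y γ
      y-misses-γ₁ = recolour-missing-away φ x z _ (proj₁ (away (here refl))) (proj₂ (away (here refl))) y-misses-γ
      fan₁ : Fan φ₁ _
      fan₁ = fan-transport fan
        (λ v v∈ → recolour-off φ x z _ (not-sameEdge-end x≢z (proj₂ (away v∈))))
        (λ a _ _ pr _ → recolour-missing-away φ x z _ (proj₁ (away (precedes-∈ʳ pr))) (proj₂ (away (precedes-∈ʳ pr))))

    -- Vizing's recolouring argument, localised: if x and all its neighbours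
    -- have degree below c, the uncoloured edge x y₀ can be coloured without
    -- uncolouring any other edge.
    module Vizing (φ : Colouring) (good : Good φ) (deg-x : deg x < c)
                  (deg-nbrs : ∀ w → H x w ≡ true → deg w < c) where

      α : Fin c
      α = proj₁ (missing-colour φ good x deg-x)

      x-misses-α : Missing φ x α
      x-misses-α = proj₂ (missing-colour φ good x deg-x)

      edge-at-x-not-α : ∀ b γ → φ x b ≡ just γ → γ ≢ α
      edge-at-x-not-α b γ xb refl = x-misses-α b xb

      -- The fan closes up: x z has the colour β missing at the head y, and z is
      -- already in the fan.  Interchange α and β outside the α/β-chain W of x.
      -- If z's successor a is outside W it now misses α and the sub-fan from a
      -- rotates; otherwise y is outside W (W has only one end besides x) and
      -- the whole fan rotates.
      kempe-case : ∀ y t z β → Fan φ (y ∷ t) → Missing φ y β → φ x z ≡ just β →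
        SuccessorOf φ (y ∷ t) z β → Extension φ x y₀
      kempe-case y t z β fan y-misses-β xz pred = by-side (W a) refl
        where
        open Interchange α β
        open KempeChain φ good x x-misses-α
        open Chain chain
        open SuccessorOf pred

        ψ : Colouring
        ψ = interchange W φ

        x-misses-α-in-ψ : Missing ψ x α
        x-misses-α-in-ψ = interchange-missing W φ x α (λ Wx → ⊥-elim (true≢false contains-x Wx)) x-misses-α

        transport : ∀ {ys} → Fan φ ys →
          (∀ q b γ → Precedes b q ys → φ x b ≡ just γ → W q ≡ false → γ ≢ β) → Fan ψ ys
        transport fan′ not-β = fan-transport fan′
          (λ v _ → interchange-inside W φ x v contains-x)
          (λ q b γ pr xb → interchange-missing W φ q γ (λ Wq → edge-at-x-not-α b γ xb , not-β q b γ pr xb Wq))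

        rotate-from : ∀ {h hs} → Fan ψ (h ∷ hs) → W h ≡ false → Missing φ h β → Extension φ x y₀
        rotate-from {h} fan′ Wh h-misses-β = extension-via (interchange-⊒ W φ)
          (rotate ψ α (good-interchange φ W good closed) fan′ (interchange-missing-β W φ h Wh h-misses-β) x-misses-α-in-ψ)

        is-z : ∀ {b} → φ x b ≡ just β → b ≡ z
        is-z xb = proper good x _ z β xb xz

        -- if a ∈ W then y ∉ W: both miss β, so both would be the end of the chain
        y-outside : W a ≡ true → W y ≡ false
        y-outside Wa with W y in Wy
        ... | false = refl
        ... | true  = ⊥-elim (fan-head-fresh fan (subst (_∈ t) a≡y (precedes-∈-tail z-precedes-a)))
          where
          off-x : ∀ {ys v} → Fan φ ys → v ∈ ys → v ≢ x
          off-x fan′ v∈ v≡x = H-distinct (fan-adjacent good fan′ v∈) (sym v≡x)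
          a≡y : a ≡ y
          a≡y = one-end a y Wa Wy (off-x sub-fan (here refl)) (off-x fan (here refl)) a-misses-β y-misses-β

        by-side : ∀ s → W a ≡ s → Extension φ x y₀
        -- a outside W: the sub-fan from a avoids z, the only β-edge at x
        by-side false Wa = rotate-from (transport sub-fan not-β) Wa a-misses-β
          where
          not-β : ∀ q b γ → Precedes b q (a ∷ rest) → φ x b ≡ just γ → W q ≡ false → γ ≢ β
          not-β q b γ pr xb _ refl = z∉sub-fan (subst (_∈ _) (is-z xb) (precedes-∈ˡ pr))
        -- a inside W: in the whole fan only a follows the β-edge x z, and a is not outside W
        by-side true Wa = rotate-from (transport fan not-β) (y-outside Wa) y-misses-β
          where
          not-β : ∀ q b γ → Precedes b q (y ∷ t) → φ x b ≡ just γ → W q ≡ false → γ ≢ β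
          not-β q b γ pr xb Wq refl = true≢false (subst (λ v → W v ≡ true) a≡q Wa) Wq
            where
            a≡q : a ≡ q
            a≡q = fan-successor-unique fan z-precedes-a (subst (λ b → Precedes b q _) (is-z xb) pr)

      -- termination measure: vertices not yet in the fan
      unused : List (Fin n) → ℕ
      unused ys = countFin n (λ v → not (does (v ∈? ys)))

      unused-shrinks : ∀ {z ys} → z ∉ ys → unused (z ∷ ys) < unused ys
      unused-shrinks {z} {ys} z∉ = countFin-strict n _ _ stays z
        (cong not (dec-true (z ∈? z ∷ ys) (here refl))) (cong not (dec-false (z ∈? ys) z∉))
        where
        stays : ∀ v → not (does (v ∈? z ∷ ys)) ≡ true → not (does (v ∈? ys)) ≡ true
        stays v outside = cong not (dec-false (v ∈? ys) λ v∈ →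
          true≢false (trans (cong not (sym (dec-true (v ∈? z ∷ ys) (there v∈)))) outside) refl)

      -- Grow the fan until its head and x share a missing colour (rotate it) or
      -- it closes up (Kempe case); each step adds a new neighbour of x.
      grow-fan : (fuel : ℕ) → ∀ {y t} → Fan φ (y ∷ t) → unused (y ∷ t) < fuel → Extension φ x y₀
      grow-fan (suc fuel) {y} {t} fan bound
        with missing-colour φ good y (deg-nbrs y (fan-adjacent good fan (here refl)))
      ... | β , y-misses-β with missing? φ x β
      ...   | yes x-misses-β = rotate φ β good fan y-misses-β x-misses-β
      ...   | no ¬x-misses-β with present φ x β ¬x-misses-β
      ...     | z , xz with z ∈? (y ∷ t)
      ...       | yes z∈ = kempe-case y t z β fan y-misses-β xz (successor-of fan z∈ xz)
      ...       | no  z∉ = grow-fan fuel (step z β fan z∉ xz y-misses-β) (<-≤-trans (unused-shrinks z∉) (≤-pred bound))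

      extension : H x y₀ ≡ true → φ x y₀ ≡ nothing → Extension φ x y₀
      extension Hxy₀ uncoloured = grow-fan (suc n) (base Hxy₀ uncoloured) (s≤s (countFin-≤ n _))

module Reduction {n : ℕ} (G : Graph n) (c : ℕ) (D : Fin n → Fin n → Bool)
  (small-degree : ∀ v → vert G v ≡ true → degMinus G D v < c) where

  G′ : Graph n
  G′ = reduce G D

  G′⊆G : ∀ u v → adj G′ u v ≡ true → adj G u v ≡ true
  G′⊆G u v = ∧-true-l

  restrict : ∀ k → ECS G c k → ECS G′ c k
  restrict k (lab , labeling , proper-lab , few-weak) =
      lab
    , (λ u v e → labeling u v (G′⊆G u v e))
    , (λ u v w i e₁ e₂ → proper-lab u v w i (G′⊆G u v e₁) (G′⊆G u w e₂))
    , ≤-trans (weakCount-mono G′ G c lab lab (λ u v e weak → ∧-true (G′⊆G u v e) weak)) few-weak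

  -- A deleted vertex lies outside 𝒞, and so do its neighbours (else it would
  -- lie in N(𝒞)).
  deleted-outside-𝒞 : ∀ x → keep G D x ≡ false →
    inC D x ≡ false × (∀ w → adj G x w ≡ true → inC D w ≡ false)
  deleted-outside-𝒞 x kept = ∨-false-l kept , nbr-outside
    where
    nbr-outside : ∀ w → adj G x w ≡ true → inC D w ≡ false
    nbr-outside w xw with inC D w in w∈𝒞
    ... | false = refl
    ... | true  = ⊥-elim (true≢false
                    (anyFin-witness n (λ u → inC D u ∧ adj G u x) w (∧-true w∈𝒞 (trans (adj-sym G w x) xw)))
                    (∨-false-r {inC D x} kept))

  -- Outside 𝒞 no edge of D is incident, so any subgraph degree is below c.
  outside-𝒞-degree : ∀ (H : Fin n → Fin n → Bool) v → (∀ w → H v w ≡ true → adj G v w ≡ true) →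
    vert G v ≡ true → inC D v ≡ false → countFin n (H v) < c
  outside-𝒞-degree H v H⊆G v∈V v∉𝒞 = ≤-<-trans
    (countFin-mono n (H v) _ λ w vw → ∧-true (H⊆G w vw) (cong not (anyFin-none n (D v) w v∉𝒞)))
    (small-degree v v∈V)

  -- Conversely a labeling L′ of G′ extends to G with no new weak edges: the
  -- strong edges of G′ together with all edges of G missing from G′ form a
  -- graph H, L′ is a partial proper colouring of H, and every uncoloured
  -- edge of H has a deleted endpoint, where Vizing's argument colours it.
  module Extend (lab′ : Fin n → Fin n → Maybe (Fin c)) (labeling′ : IsLabeling G′ c lab′)
                (proper′ : IsProper G′ c lab′) where

    Weak : Fin n → Fin n → Bool
    Weak u v = adj G′ u v ∧ is-nothing (lab′ u v)

    Weak-sym : ∀ u v → Weak u v ≡ Weak v u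
    Weak-sym u v with adj G′ u v in uv
    ... | true  rewrite labeling′ u v uv | sym (adj-sym G′ u v) | uv = refl
    ... | false rewrite sym (adj-sym G′ u v) | uv = refl

    H : Fin n → Fin n → Bool
    H u v = adj G u v ∧ not (Weak u v)

    H⊆G : ∀ u v → H u v ≡ true → adj G u v ≡ true
    H⊆G u v = ∧-true-l

    H-sym : ∀ u v → H u v ≡ H v u
    H-sym u v = cong₂ _∧_ (adj-sym G u v) (cong not (Weak-sym u v))

    H-irrefl : ∀ v → H v v ≡ false
    H-irrefl v rewrite adj-irr G v = refl

    open PartialColouring c H H-sym H-irrefl

    φ₀ : Colouring
    φ₀ u v with adj G′ u v
    ... | true  = lab′ u v
    ... | false = nothing

    φ₀-on : ∀ u v → adj G′ u v ≡ true → φ₀ u v ≡ lab′ u v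
    φ₀-on u v uv with adj G′ u v
    ... | true = refl

    φ₀-off : ∀ u v → adj G′ u v ≡ false → φ₀ u v ≡ nothing
    φ₀-off u v uv with adj G′ u v
    ... | false = refl

    φ₀-just : ∀ u v i → φ₀ u v ≡ just i → adj G′ u v ≡ true × lab′ u v ≡ just i
    φ₀-just u v i eq with adj G′ u v
    ... | true = refl , eq

    good₀ : Good φ₀
    good₀ = record { symmetric = symm ; supported = supp ; proper = prop }
      where
      symm : ∀ u v → φ₀ u v ≡ φ₀ v u
      symm u v with adj G′ u v in uv
      ... | true  = trans (labeling′ u v uv) (sym (φ₀-on v u (trans (adj-sym G′ v u) uv)))
      ... | false = sym (φ₀-off v u (trans (adj-sym G′ v u) uv))
      supp : ∀ u v i → φ₀ u v ≡ just i → H u v ≡ true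
      supp u v i eq with φ₀-just u v i eq
      ... | uv , labelled rewrite uv | labelled | G′⊆G u v uv = refl
      prop : ∀ u v w i → φ₀ u v ≡ just i → φ₀ u w ≡ just i → v ≡ w
      prop u v w i eq₁ eq₂ with v ≟ w
      ... | yes v≡w = v≡w
      ... | no  v≢w = ⊥-elim (proper′ u v w i (proj₁ (φ₀-just u v i eq₁)) (proj₁ (φ₀-just u w i eq₂)) v≢w
                              (proj₂ (φ₀-just u v i eq₁)) (proj₂ (φ₀-just u w i eq₂)))

    -- An edge of H uncoloured by φ₀ is not an edge of G′, so it has a deleted endpoint.
    uncoloured-deleted-endpoint : ∀ u v → H u v ≡ true → φ₀ u v ≡ nothing →
      (keep G D u ≡ false) ⊎ (keep G D v ≡ false)
    uncoloured-deleted-endpoint u v Huv uncoloured = ∧-false (∧-false-r (H⊆G u v Huv) not-in-G′)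
      where
      in-G′⇒weak : adj G′ u v ≡ true → Weak u v ≡ true
      in-G′⇒weak uv = ∧-true uv (≡nothing⇒is-nothing (trans (sym (φ₀-on u v uv)) uncoloured))
      not-in-G′ : adj G′ u v ≡ false
      not-in-G′ = ¬-not λ uv → true≢false (in-G′⇒weak uv) (not-true⇒false (∧-true-r Huv))

    deleted-vertex-degrees : ∀ x y → keep G D x ≡ false → H x y ≡ true →
      deg x < c × (∀ w → H x w ≡ true → deg w < c)
    deleted-vertex-degrees x y x-deleted Hxy =
        outside-𝒞-degree H x (H⊆G x) (adj-V G x y (H⊆G x y Hxy)) (proj₁ (deleted-outside-𝒞 x x-deleted))
      , λ w Hxw → outside-𝒞-degree H w (H⊆G w) (adj-V G w x (trans (adj-sym G w x) (H⊆G x w Hxw)))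
                    (proj₂ (deleted-outside-𝒞 x x-deleted) w (H⊆G x w Hxw))

    extend-at-deleted : ∀ φ → Good φ → ∀ x y → keep G D x ≡ false → H x y ≡ true → φ x y ≡ nothing →
      Extension φ x y
    extend-at-deleted φ good x y x-deleted Hxy xy = Fans.Vizing.extension x y φ good
      (proj₁ (deleted-vertex-degrees x y x-deleted Hxy)) (proj₂ (deleted-vertex-degrees x y x-deleted Hxy)) Hxy xy

    colour-edge : ∀ φ → Good φ → φ ⊒ φ₀ → ∀ u v → H u v ≡ true → Extension φ u v
    colour-edge φ good φ⊒φ₀ u v Huv with φ u v in uv
    ... | just i  = record { colouring = φ ; is-good = good ; colours = i , uv ; extends = λ _ _ e → e }
    ... | nothing with uncoloured-deleted-endpoint u v Huv (φ⊒φ₀ u v uv)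
    ...   | inj₁ u-deleted = extend-at-deleted φ good u v u-deleted Huv uv
    ...   | inj₂ v-deleted = extension-flip
              (extend-at-deleted φ good v u v-deleted (trans (H-sym v u) Huv) (trans (symmetric good v u) uv))

    Covers : Colouring → List (Fin n × Fin n) → Set
    Covers φ L = ∀ u v → (u , v) ∈ L → H u v ≡ true → φ u v ≢ nothing

    colour-all : ∀ L → Σ Colouring λ φ → Good φ × φ ⊒ φ₀ × Covers φ L
    colour-all [] = φ₀ , good₀ , (λ _ _ uncoloured → uncoloured) , λ _ _ ()
    colour-all ((u , v) ∷ L) with colour-all L
    ... | φ , good , φ⊒φ₀ , covers with H u v in Huv
    ...   | false = φ , good , φ⊒φ₀ , covers′
      where
      covers′ : Covers φ ((u , v) ∷ L)
      covers′ _ _ (here refl) Huv′ _ = true≢false Huv′ Huv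
      covers′ a b (there ab∈L)      = covers a b ab∈L
    ...   | true = colouring , is-good , ⊒-trans extends φ⊒φ₀ , covers′
      where
      open Extension (colour-edge φ good φ⊒φ₀ u v Huv)
      covers′ : Covers colouring ((u , v) ∷ L)
      covers′ _ _ (here refl) _ uncoloured with () ← trans (sym (proj₂ colours)) uncoloured
      covers′ a b (there ab∈L) Hab uncoloured = covers a b ab∈L Hab (extends a b uncoloured)

    labeling-of-G : ECS G c (weakCount G′ c lab′)
    labeling-of-G =
        φ
      , (λ u v _ → symmetric good u v)
      , (λ u v w i _ _ v≢w eq₁ eq₂ → v≢w (proper good u v w i eq₁ eq₂))
      , weakCount-mono G G′ c φ lab′ weak⇒weak
      where
      coloured : Σ Colouring λ φ → Good φ × φ ⊒ φ₀ × Covers φ (cartesianProduct (allFin n) (allFin n))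
      coloured = colour-all (cartesianProduct (allFin n) (allFin n))
      φ : Colouring
      φ = proj₁ coloured
      good : Good φ
      good = proj₁ (proj₂ coloured)
      covers : Covers φ (cartesianProduct (allFin n) (allFin n))
      covers = proj₂ (proj₂ (proj₂ coloured))
      weak⇒weak : ∀ u v → adj G u v ≡ true → is-nothing (φ u v) ≡ true → Weak u v ≡ true
      weak⇒weak u v uv uncoloured with Weak u v in weak
      ... | true  = refl
      ... | false = ⊥-elim (covers u v (∈-cartesianProduct⁺ (∈-allFin u) (∈-allFin v))
                      (∧-true uv (cong not weak)) (is-nothing⇒≡nothing uncoloured))

  extend : ∀ k → ECS G′ c k → ECS G c k
  extend k (lab′ , labeling′ , proper′ , few-weak) with Extend.labeling-of-G lab′ labeling′ proper′
  ... | lab , labeling , proper-lab , fewer-weak = lab , labeling , proper-lab , ≤-trans fewer-weak few-weak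

-- Restriction and extension give both directions.
proposition10 : ∀ {n} (G : Graph n) (c k : ℕ) (D : Fin n → Fin n → Bool) →
    IsEdgeSubset G D →
    (∀ v → vert G v ≡ true → degMinus G D v < c) →
    ECS G c k ⇔ ECS (reduce G D) c k
proposition10 G c k D _ small-degree = mk⇔ (restrict k) (extend k)
  where open Reduction G c D small-degree
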